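{- Let $\mathcal{E}$ be a system of $m$ Boolean equations in $L$ variables. If $\mathcal{E}$ has a solution over $\mathbb{N}$, then $\mathcal{E}$ has a solution over $\mathbb{N}$ with at most $m \log_2(L+1)$ non-zero entries.
   Context: A Boolean equation is an equation of the form $a_1 x_1 + \cdots + a_n x_n = c$, where each $a_i \in \{0,1\}$ and $c$ is a natural number. $\mathbb{N}$ denotes the natural numbers including $0$. -}

module Defs where

open import Data.Nat using (ℕ; zero; suc; _+_; _*_; _^_; _≤_)
open import Data.Bool using (Bool; true; false; if_then_else_)
open import Data.Fin using (Fin)
open import Data.Vec.Functional using (Vector; foldr)

sumV : ∀ {n} → Vector ℕ n → ℕ
sumV = foldr _+_ 0

-- A system of m Boolean equations in L variables:
-- equation i reads  Σ_j A i j * x j = c i  with A i j ∈ {0,1} (as Bool).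
record BoolSystem (m L : ℕ) : Set where
  field
    coeff : Fin m → Fin L → Bool
    rhs   : Fin m → ℕ

bmul : Bool → ℕ → ℕ
bmul b x = if b then x else 0

IsSolution : ∀ {m L} → BoolSystem m L → (Fin L → ℕ) → Set
IsSolution {m} {L} E x =
  (i : Fin m) → sumV (λ j → bmul (BoolSystem.coeff E i j) (x j)) ≡ BoolSystem.rhs E i
  where open import Relation.Binary.PropositionalEquality using (_≡_)

nonZeroCount : ∀ {L} → (Fin L → ℕ) → ℕ
nonZeroCount x = sumV (λ j → isNZ (x j))
  where
  isNZ : ℕ → ℕ
  isNZ zero    = 0
  isNZ (suc _) = 1

{-# OPTIONS --safe #-}
-- If a solution y has k non-zero entries with 2^k > (L+1)^m, then among the 2^k subsets T of its
-- support two distinct ones, T₁ and T₂, have the same row sums (|A_i ∩ T|)_i, since these take at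
-- most (L+1)^m values; hence so do D₁ = T₁ ∖ T₂ and D₂ = T₂ ∖ T₁. Moving the least value t of y on
-- D₁ from D₁ to D₂, i.e. passing to y − t·1_{D₁} + t·1_{D₂}, gives a solution with smaller support,
-- so repeating this ends in a solution with 2^k ≤ (L+1)^m.

module Submission where

open import Defs
open import Data.Nat using (ℕ; suc; _^_; _≤_)
open import Data.Fin using (Fin)
open import Data.Product using (Σ; _×_)

open import Data.Bool using (Bool; true; false; _∧_; not)
open import Data.Bool.Properties using (∧-comm) renaming (_≟_ to _≟ᴮ_)
open import Data.Fin using (zero; suc; toℕ; fromℕ<; combine; finToFun; funToFin)
open import Data.Fin.Properties
  using (pigeonhole; ¬∀⟶∃¬; <⇒≢; toℕ-fromℕ<; finToFun-funToFin; funToFin-finToFin; 2↔Bool)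
open import Data.List using (filter; allFin)
open import Data.List.Extrema.Nat using (argmin; argmin-all; f[argmin]≤f[xs])
open import Data.List.Membership.Propositional.Properties using (∈-filter⁺; ∈-allFin)
open import Data.List.Relation.Unary.All using (lookup)
open import Data.List.Relation.Unary.All.Properties using (all-filter)
open import Data.Nat using (zero; _+_; _*_; _∸_; _<_; z≤n; s≤s; _≤?_)
open import Data.Nat.Induction using (<-wellFounded)
open import Data.Nat.Properties
  using ( ≤-refl; ≤-trans; ≰⇒>; m≤n⇒m≤1+n; m<n⇒m<1+n; +-mono-≤; +-identityʳ; +-cancelʳ-≡
        ; *-identityʳ; *-zeroʳ; n∸n≡0; m∸n+n≡m; +-*-semiring; module ≤-Reasoning)
open import Algebra.Properties.Semiring.Sum +-*-semiring
  using (sum; sum-cong-≗; ∑-distrib-+; *-distribˡ-sum)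
open import Data.Product using (_,_)
open import Data.Sum using (_⊎_; inj₁; inj₂; [_,_])
open import Data.Vec.Functional using (_∷_)
open import Function using (_∘_; Inverse)
open import Induction.WellFounded using (Acc; acc)
open import Relation.Binary.PropositionalEquality
  using (_≡_; _≢_; refl; sym; trans; cong; cong₂; module ≡-Reasoning)
open import Relation.Nullary using (yes; no; contradiction)

open BoolSystem

private
  variable
    m L : ℕ

argmin-on : ∀ {n} (D : Fin n → Bool) (f : Fin n → ℕ) {p} → D p ≡ true →
            Σ (Fin n) λ j → D j ≡ true × (∀ k → D k ≡ true → f j ≤ f k)
argmin-on {n} D f {p} p∈D = argmin f p xs , argmin-all f p∈D (all-filter D? (allFin n)) , minimal
  where
  D? = λ k → D k ≟ᴮ true
  xs = filter D? (allFin n)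
  minimal : ∀ k → D k ≡ true → f (argmin f p xs) ≤ f k
  minimal k k∈D = lookup (f[argmin]≤f[xs] p xs) (∈-filter⁺ D? (∈-allFin k) k∈D)

sum-bounded : ∀ {n} (x : Fin n → ℕ) {c} → (∀ j → x j ≤ c) → sum x ≤ n * c
sum-bounded {zero}  x x≤c = z≤n
sum-bounded {suc n} x x≤c = +-mono-≤ (x≤c zero) (sum-bounded (x ∘ suc) (x≤c ∘ suc))

funToFin-cong : ∀ {k n} {f g : Fin k → Fin n} → (∀ i → f i ≡ g i) → funToFin f ≡ funToFin g
funToFin-cong {zero}  f≗g = refl
funToFin-cong {suc k} f≗g = cong₂ combine (f≗g zero) (funToFin-cong (f≗g ∘ suc))

funToFin-injective : ∀ {k n} {f g : Fin k → Fin n} → funToFin f ≡ funToFin g → ∀ i → f i ≡ g i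
funToFin-injective {f = f} {g} eq i = trans (sym (finToFun-funToFin f i))
  (trans (cong (λ c → finToFun c i) eq) (finToFun-funToFin g i))

finToFun-injective : ∀ {k n} {c c' : Fin (n ^ k)} → (∀ i → finToFun c i ≡ finToFun c' i) → c ≡ c'
finToFun-injective {k} {n} {c} {c'} eq = trans (sym (funToFin-finToFin {k} c))
  (trans (funToFin-cong {k} {n} eq) (funToFin-finToFin {k} c'))

bmul-distribˡ-+ : ∀ b x z → bmul b (x + z) ≡ bmul b x + bmul b z
bmul-distribˡ-+ true  x z = refl
bmul-distribˡ-+ false x z = refl

bmul-*-comm : ∀ b t x → bmul b (t * x) ≡ t * bmul b x
bmul-*-comm true  t x = refl
bmul-*-comm false t x = sym (*-zeroʳ t)

bmul-≤ : ∀ b x → bmul b x ≤ x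
bmul-≤ true  x = ≤-refl
bmul-≤ false x = z≤n

_·_ : (Fin L → Bool) → (Fin L → ℕ) → ℕ
a · x = sum (λ j → bmul (a j) (x j))

·-cong : ∀ (a : Fin L → Bool) {x z} → (∀ j → x j ≡ z j) → a · x ≡ a · z
·-cong a x≗z = sum-cong-≗ (λ j → cong (bmul (a j)) (x≗z j))

·-distribˡ-+ : ∀ (a : Fin L → Bool) x z → a · (λ j → x j + z j) ≡ a · x + a · z
·-distribˡ-+ a x z = trans (sum-cong-≗ (λ j → bmul-distribˡ-+ (a j) (x j) (z j)))
                            (∑-distrib-+ (λ j → bmul (a j) (x j)) (λ j → bmul (a j) (z j)))

·-*-comm : ∀ (a : Fin L → Bool) t x → a · (λ j → t * x j) ≡ t * (a · x)
·-*-comm a t x = trans (sum-cong-≗ (λ j → bmul-*-comm (a j) t (x j)))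
                        (sym (*-distribˡ-sum t (λ j → bmul (a j) (x j))))

indicator : ℕ → (Fin L → Bool) → Fin L → ℕ
indicator t D j = bmul (D j) t

·-indicator : ∀ (a D : Fin L → Bool) t → a · indicator t D ≡ t * (a · indicator 1 D)
·-indicator a D t = trans (·-cong a scale) (·-*-comm a t (indicator 1 D))
  where
  scale : ∀ j → indicator t D j ≡ t * indicator 1 D j
  scale j with D j
  ... | true  = sym (*-identityʳ t)
  ... | false = sym (*-zeroʳ t)

·-indicator-≤ : ∀ (a T : Fin L → Bool) → a · indicator 1 T ≤ L
·-indicator-≤ {L} a T = begin
  a · indicator 1 T ≤⟨ sum-bounded _ (λ j → ≤-trans (bmul-≤ (a j) _) (bmul-≤ (T j) 1)) ⟩
  L * 1             ≡⟨ *-identityʳ L ⟩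
  L                 ∎
  where open ≤-Reasoning

Balanced : BoolSystem m L → (Fin L → ℕ) → (Fin L → ℕ) → Set
Balanced E u v = ∀ i → coeff E i · u ≡ coeff E i · v

exchange-isSolution : ∀ (E : BoolSystem m L) {y u v} → IsSolution E y →
                      (∀ j → u j ≤ y j) → Balanced E u v →
                      IsSolution E (λ j → y j ∸ u j + v j)
exchange-isSolution E {y} {u} {v} sol u≤y bal i = begin
  a · (λ j → y∸u j + v j) ≡⟨ ·-distribˡ-+ a y∸u v ⟩
  a · y∸u + a · v          ≡⟨ cong (a · y∸u +_) (sym (bal i)) ⟩
  a · y∸u + a · u          ≡⟨ sym (·-distribˡ-+ a y∸u u) ⟩
  a · (λ j → y∸u j + u j) ≡⟨ ·-cong a (λ j → m∸n+n≡m (u≤y j)) ⟩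
  a · y                    ≡⟨ sol i ⟩
  rhs E i                  ∎
  where
  open ≡-Reasoning
  a = coeff E i
  y∸u = λ j → y j ∸ u j

Balanced-scale : ∀ (E : BoolSystem m L) {D₁ D₂} t →
                 Balanced E (indicator 1 D₁) (indicator 1 D₂) →
                 Balanced E (indicator t D₁) (indicator t D₂)
Balanced-scale E {D₁} {D₂} t bal i =
  trans (·-indicator a D₁ t) (trans (cong (t *_) (bal i)) (sym (·-indicator a D₂ t)))
  where a = coeff E i

nonZeroCount-mono : ∀ (y z : Fin L → ℕ) → (∀ j → y j ≡ 0 → z j ≡ 0) →
                    nonZeroCount z ≤ nonZeroCount y
nonZeroCount-mono {zero}  y z z⊆y = z≤n
nonZeroCount-mono {suc L} y z z⊆y with y zero in y₀ | z zero in z₀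
... | zero  | zero  = nonZeroCount-mono (y ∘ suc) (z ∘ suc) (z⊆y ∘ suc)
... | zero  | suc _ = contradiction (trans (sym z₀) (z⊆y zero y₀)) λ ()
... | suc _ | zero  = m≤n⇒m≤1+n (nonZeroCount-mono (y ∘ suc) (z ∘ suc) (z⊆y ∘ suc))
... | suc _ | suc _ = s≤s (nonZeroCount-mono (y ∘ suc) (z ∘ suc) (z⊆y ∘ suc))

nonZeroCount-< : ∀ (y z : Fin L → ℕ) → (∀ j → y j ≡ 0 → z j ≡ 0) →
                 ∀ p → z p ≡ 0 → y p ≢ 0 → nonZeroCount z < nonZeroCount y
nonZeroCount-< {suc L} y z z⊆y zero zp≡0 yp≢0 with y zero | z zero
... | zero  | _     = contradiction refl yp≢0
... | suc _ | zero  = s≤s (nonZeroCount-mono (y ∘ suc) (z ∘ suc) (z⊆y ∘ suc))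
nonZeroCount-< {suc L} y z z⊆y (suc p) zp≡0 yp≢0 with y zero in y₀ | z zero in z₀
... | zero  | zero  = nonZeroCount-< (y ∘ suc) (z ∘ suc) (z⊆y ∘ suc) p zp≡0 yp≢0
... | zero  | suc _ = contradiction (trans (sym z₀) (z⊆y zero y₀)) λ ()
... | suc _ | zero  = m<n⇒m<1+n (nonZeroCount-< (y ∘ suc) (z ∘ suc) (z⊆y ∘ suc) p zp≡0 yp≢0)
... | suc _ | suc _ = s≤s (nonZeroCount-< (y ∘ suc) (z ∘ suc) (z⊆y ∘ suc) p zp≡0 yp≢0)

_⊆-support_ : (Fin L → Bool) → (Fin L → ℕ) → Set
D ⊆-support y = ∀ j → y j ≡ 0 → D j ≡ false

Disjoint : (Fin L → Bool) → (Fin L → Bool) → Set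
Disjoint D₁ D₂ = ∀ j → D₁ j ≡ true → D₂ j ≡ false

SmallerSolution : BoolSystem m L → (Fin L → ℕ) → Set
SmallerSolution {L = L} E y =
  Σ (Fin L → ℕ) λ y' → IsSolution E y' × nonZeroCount y' < nonZeroCount y

shrinkSupport : ∀ (E : BoolSystem m L) {y D₁ D₂ p} → IsSolution E y →
                D₁ ⊆-support y → D₂ ⊆-support y → Disjoint D₁ D₂ →
                Balanced E (indicator 1 D₁) (indicator 1 D₂) → D₁ p ≡ true →
                SmallerSolution E y
shrinkSupport {L = L} E {y} {D₁} {D₂} sol D₁⊆y D₂⊆y disj bal p∈D₁
  with j₀ , j₀∈D₁ , minimal ← argmin-on D₁ y p∈D₁ =
  y' , exchange-isSolution E sol u≤y (Balanced-scale E t bal) ,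
  nonZeroCount-< y y' y'⊆y j₀ y'j₀≡0 yj₀≢0
  where
  t = y j₀
  y' : Fin L → ℕ
  y' j = y j ∸ indicator t D₁ j + indicator t D₂ j
  u≤y : ∀ j → indicator t D₁ j ≤ y j
  u≤y j with D₁ j in j∈D₁
  ... | true  = minimal j j∈D₁
  ... | false = z≤n
  y'⊆y : ∀ j → y j ≡ 0 → y' j ≡ 0
  y'⊆y j yj≡0 rewrite D₁⊆y j yj≡0 | D₂⊆y j yj≡0 | yj≡0 = refl
  y'j₀≡0 : y' j₀ ≡ 0
  y'j₀≡0 rewrite j₀∈D₁ | disj j₀ j₀∈D₁ = trans (+-identityʳ _) (n∸n≡0 t)
  yj₀≢0 : y j₀ ≢ 0
  yj₀≢0 yj₀≡0 = contradiction (trans (sym j₀∈D₁) (D₁⊆y j₀ yj₀≡0)) λ ()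

_∖_ _∩_ : (Fin L → Bool) → (Fin L → Bool) → Fin L → Bool
(T₁ ∖ T₂) j = T₁ j ∧ not (T₂ j)
(T₁ ∩ T₂) j = T₁ j ∧ T₂ j

∖-⊆-support : ∀ {T₁ T₂ : Fin L → Bool} {y} → T₁ ⊆-support y → (T₁ ∖ T₂) ⊆-support y
∖-⊆-support T₁⊆y j yj≡0 rewrite T₁⊆y j yj≡0 = refl

∖-disjoint : ∀ (T₁ T₂ : Fin L → Bool) → Disjoint (T₁ ∖ T₂) (T₂ ∖ T₁)
∖-disjoint T₁ T₂ j with T₁ j | T₂ j
... | true  | false = λ _ → refl
... | true  | true  = λ ()
... | false | _     = λ ()

≢⇒∖ : ∀ {a b} → a ≢ b → a ∧ not b ≡ true ⊎ b ∧ not a ≡ true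
≢⇒∖ {true}  {false} _   = inj₁ refl
≢⇒∖ {false} {true}  _   = inj₂ refl
≢⇒∖ {true}  {true}  a≢b = contradiction refl a≢b
≢⇒∖ {false} {false} a≢b = contradiction refl a≢b

·-indicator-∖ : ∀ (a T₁ T₂ : Fin L → Bool) →
                a · indicator 1 T₁ ≡ a · indicator 1 (T₁ ∖ T₂) + a · indicator 1 (T₁ ∩ T₂)
·-indicator-∖ a T₁ T₂ =
  trans (·-cong a (λ j → split (T₁ j) (T₂ j))) (·-distribˡ-+ a _ _)
  where
  split : ∀ b b' → bmul b 1 ≡ bmul (b ∧ not b') 1 + bmul (b ∧ b') 1
  split true  true  = refl
  split true  false = refl
  split false _     = refl

Balanced-∖ : ∀ (E : BoolSystem m L) {T₁ T₂} →
             Balanced E (indicator 1 T₁) (indicator 1 T₂) →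
             Balanced E (indicator 1 (T₁ ∖ T₂)) (indicator 1 (T₂ ∖ T₁))
Balanced-∖ E {T₁} {T₂} bal i = +-cancelʳ-≡ (a · indicator 1 (T₁ ∩ T₂)) _ _ (begin
  a · indicator 1 (T₁ ∖ T₂) + a · indicator 1 (T₁ ∩ T₂) ≡⟨ sym (·-indicator-∖ a T₁ T₂) ⟩
  a · indicator 1 T₁                                     ≡⟨ bal i ⟩
  a · indicator 1 T₂                                     ≡⟨ ·-indicator-∖ a T₂ T₁ ⟩
  a · indicator 1 (T₂ ∖ T₁) + a · indicator 1 (T₂ ∩ T₁) ≡⟨ cong (a · indicator 1 (T₂ ∖ T₁) +_) ∩-comm ⟩
  a · indicator 1 (T₂ ∖ T₁) + a · indicator 1 (T₁ ∩ T₂) ∎)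
  where
  open ≡-Reasoning
  a = coeff E i
  ∩-comm : a · indicator 1 (T₂ ∩ T₁) ≡ a · indicator 1 (T₁ ∩ T₂)
  ∩-comm = ·-cong a (λ j → cong (λ b → bmul b 1) (∧-comm (T₂ j) (T₁ j)))

shrinkSupport-∖ : ∀ (E : BoolSystem m L) {y T₁ T₂ p} → IsSolution E y →
                  T₁ ⊆-support y → T₂ ⊆-support y →
                  Balanced E (indicator 1 T₁) (indicator 1 T₂) → (T₁ ∖ T₂) p ≡ true →
                  SmallerSolution E y
shrinkSupport-∖ E {T₁ = T₁} {T₂} sol T₁⊆y T₂⊆y bal = shrinkSupport E sol
  (∖-⊆-support T₁⊆y) (∖-⊆-support T₂⊆y) (∖-disjoint T₁ T₂) (Balanced-∖ E bal)

onSupport : ∀ {A : Set} (y : Fin L → ℕ) → A → (Fin (nonZeroCount y) → A) → Fin L → A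
onSupport {zero}  y a = λ _ ()
onSupport {suc L} y a with y zero
... | zero  = λ B → a ∷ onSupport (y ∘ suc) a B
... | suc _ = λ B → B zero ∷ onSupport (y ∘ suc) a (B ∘ suc)

onSupport-zero : ∀ {A : Set} (y : Fin L → ℕ) (a : A) B j → y j ≡ 0 → onSupport y a B j ≡ a
onSupport-zero {suc L} y a B zero y₀≡0 with y zero
onSupport-zero {suc L} y a B zero y₀≡0 | zero = refl
onSupport-zero {suc L} y a B zero ()   | suc _
onSupport-zero {suc L} y a B (suc j) yj≡0 with y zero
... | zero  = onSupport-zero (y ∘ suc) a B j yj≡0
... | suc _ = onSupport-zero (y ∘ suc) a (B ∘ suc) j yj≡0

onSupport-injective : ∀ {A : Set} (y : Fin L → ℕ) (a : A) B B' →
                      (∀ j → onSupport y a B j ≡ onSupport y a B' j) → ∀ q → B q ≡ B' q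
onSupport-injective {suc L} y a B B' eq q with y zero
... | zero = onSupport-injective (y ∘ suc) a B B' (eq ∘ suc) q
onSupport-injective {suc L} y a B B' eq zero    | suc _ = eq zero
onSupport-injective {suc L} y a B B' eq (suc q) | suc _ =
  onSupport-injective (y ∘ suc) a (B ∘ suc) (B' ∘ suc) (eq ∘ suc) q

subsetOfSupport : (y : Fin L → ℕ) → Fin (2 ^ nonZeroCount y) → Fin L → Bool
subsetOfSupport y c = onSupport y false (Inverse.to 2↔Bool ∘ finToFun c)

subsetOfSupport-⊆ : ∀ (y : Fin L → ℕ) c → subsetOfSupport y c ⊆-support y
subsetOfSupport-⊆ y c = onSupport-zero y false _

subsetOfSupport-injective : ∀ (y : Fin L → ℕ) {c c'} →
                            (∀ j → subsetOfSupport y c j ≡ subsetOfSupport y c' j) → c ≡ c'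
subsetOfSupport-injective y {c} {c'} eq = finToFun-injective {nonZeroCount y} {2} λ q →
  trans (sym (strictlyInverseʳ (finToFun c q)))
    (trans (cong from (onSupport-injective y false _ _ eq q)) (strictlyInverseʳ (finToFun c' q)))
  where open Inverse 2↔Bool

rowSums : BoolSystem m L → (Fin L → Bool) → Fin m → Fin (suc L)
rowSums E T i = fromℕ< (s≤s (·-indicator-≤ (coeff E i) T))

rowSums-Balanced : ∀ (E : BoolSystem m L) {T₁ T₂} →
                   (∀ i → rowSums E T₁ i ≡ rowSums E T₂ i) →
                   Balanced E (indicator 1 T₁) (indicator 1 T₂)
rowSums-Balanced E same i =
  trans (sym (toℕ-fromℕ< _)) (trans (cong toℕ (same i)) (toℕ-fromℕ< _))

smallerSolution : ∀ (E : BoolSystem m L) y → IsSolution E y →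
                  suc L ^ m < 2 ^ nonZeroCount y → SmallerSolution E y
smallerSolution E y sol big
  with c , c' , c<c' , same ← pigeonhole big (funToFin ∘ rowSums E ∘ subsetOfSupport y)
  with p , Tp≢T'p ← ¬∀⟶∃¬ _ _ (λ j → subsetOfSupport y c j ≟ᴮ subsetOfSupport y c' j)
                              (<⇒≢ c<c' ∘ subsetOfSupport-injective y)
  = [ shrinkSupport-∖ E sol (subsetOfSupport-⊆ y c) (subsetOfSupport-⊆ y c') bal
    , shrinkSupport-∖ E sol (subsetOfSupport-⊆ y c') (subsetOfSupport-⊆ y c) (sym ∘ bal)
    ] (≢⇒∖ Tp≢T'p)
  where bal = rowSums-Balanced E (funToFin-injective same)

SparseSolution : BoolSystem m L → Set
SparseSolution {m} {L} E = Σ (Fin L → ℕ) λ y → IsSolution E y × 2 ^ nonZeroCount y ≤ suc L ^ m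

minimizeSupport : ∀ (E : BoolSystem m L) y → IsSolution E y → Acc _<_ (nonZeroCount y) →
                  SparseSolution E
minimizeSupport {m} {L} E y sol (acc rs) with 2 ^ nonZeroCount y ≤? suc L ^ m
... | yes small = y , sol , small
... | no big    = recurse (smallerSolution E y sol (≰⇒> big))
  where
  recurse : SmallerSolution E y → SparseSolution E
  recurse (y' , sol' , fewer) = minimizeSupport E y' sol' (rs fewer)

lemma4 : (m L : ℕ) (E : BoolSystem m L) →
         Σ (Fin L → ℕ) (IsSolution E) →
         Σ (Fin L → ℕ) (λ y → IsSolution E y × 2 ^ nonZeroCount y ≤ suc L ^ m)
lemma4 m L E (y , sol) = minimizeSupport E y sol (<-wellFounded (nonZeroCount y))
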